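{- Let $r \geq 2$ be an integer and let $G$ be a (finite, simple) labelled graph with vertex set $V(G) = \{v_1, v_2, \ldots, v_n\}$, where $n \geq r+1$. Suppose that $d(u) + d(v) \geq \frac{(2r-3)n - (2r-5)}{r-1}$ for each pair $u, v$ of non-adjacent vertices of $G$, where $d(\cdot)$ denotes degree in $G$. Then for every arboreal sequence $\sigma = d_1, d_2, \ldots, d_n$ with $1 \leq d_i \leq r$ for $i = 1, 2, \ldots, n$, the graph $G$ has a spanning tree $T$ with degree sequence $\sigma$.
   Context: An arboreal sequence is a sequence of positive integers $d_1, d_2, \ldots, d_n$ such that $\sum_{j=1}^{n} d_j = 2(n-1)$. For a labelled graph $G$ with vertex set $\{v_1,\ldots,v_n\}$ and an arboreal sequence $\sigma = d_1,\ldots,d_n$, a spanning tree $T$ of $G$ has degree sequence $\sigma$ if $d_T(v_i) = d_i$ for $i = 1, 2, \ldots, n$, where $d_T(v_i)$ is the degree of $v_i$ in $T$. -}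

module Defs where

open import Data.Nat using (ℕ; zero; suc; _+_; _*_; _∸_; _≤_; _<_)
open import Data.Fin using (Fin)
open import Data.Bool using (Bool; true; false; if_then_else_)
open import Data.List using (List; []; _∷_; length; map; allFin; _++_)
open import Data.Nat.ListAction using (sum)
open import Data.List.Relation.Unary.Unique.Propositional using (Unique)
open import Data.Product using (Σ; _×_; _,_; ∃)
open import Relation.Binary.PropositionalEquality using (_≡_)
open import Relation.Nullary using (¬_)

record Graph (n : ℕ) : Set where
  field
    adj   : Fin n → Fin n → Bool
    sym   : ∀ u v → adj u v ≡ adj v u
    irrefl : ∀ v → adj v v ≡ false
open Graph public

count : ∀ {A : Set} → (A → Bool) → List A → ℕ
count p [] = 0
count p (x ∷ xs) = (if p x then 1 else 0) + count p xs

deg : ∀ {n} → Graph n → Fin n → ℕ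
deg {n} G v = count (adj G v) (allFin n)

Adjacent : ∀ {n} → Graph n → Fin n → Fin n → Set
Adjacent G u v = adj G u v ≡ true

_⊆G_ : ∀ {n} → Graph n → Graph n → Set
H ⊆G G = ∀ u v → Adjacent H u v → Adjacent G u v

data Walk {n} (G : Graph n) : Fin n → Fin n → Set where
  here : ∀ {u} → Walk G u u
  step : ∀ {u v w} → Adjacent G u v → Walk G v w → Walk G u w

Connected : ∀ {n} → Graph n → Set
Connected G = ∀ u v → Walk G u v

data Chain {n} (G : Graph n) : List (Fin n) → Set where
  nil  : Chain G []
  one  : ∀ {u} → Chain G (u ∷ [])
  cons : ∀ {u v vs} → Adjacent G u v → Chain G (v ∷ vs) → Chain G (u ∷ v ∷ vs)

HasCycle : ∀ {n} → Graph n → Set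
HasCycle {n} G = Σ (Fin n) λ x → Σ (List (Fin n)) λ ys → Σ (Fin n) λ y →
  let c = x ∷ ys ++ (y ∷ []) in
  (1 ≤ length ys) × Unique c × Chain G c × Adjacent G y x

IsTree : ∀ {n} → Graph n → Set
IsTree G = Connected G × ¬ HasCycle G

IsSpanningTree : ∀ {n} → Graph n → Graph n → Set
IsSpanningTree G T = (T ⊆G G) × IsTree T

sumFin : ∀ {n} → (Fin n → ℕ) → ℕ
sumFin {n} d = sum (map d (allFin n))

Arboreal : ∀ {n} → (Fin n → ℕ) → Set
Arboreal {n} d = (∀ i → 1 ≤ d i) × (sumFin d ≡ 2 * (n ∸ 1))

HasDegSeq : ∀ {n} → Graph n → (Fin n → ℕ) → Set
HasDegSeq T d = ∀ i → deg T i ≡ d i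

-- Spanning trees are handled as rooted trees given by parent pointers, in which a vertex has
-- degree equal to its number of children, plus one unless it is the root. A tree with degree
-- sequence σ exists (attach a leaf to a vertex of degree at least 2 and induct); among such trees
-- we decrease the number of tree edges outside G. For such an edge x–y, re-root at y, so that x
-- is a child of the root. Giving x the parent of some z ∉ {x, y} and making z a child of y (or
-- the same with x and y swapped, after re-rooting at x, when z lies below x) keeps every degree;
-- when the two new edges are in G, the number of tree edges outside G drops. If no z is suitable,
-- every z is, or has as its parent, a non-neighbour of x or of y; since no vertex has more than
-- r − 1 such children, n − 2 ≤ (r − 1)(2n − 2 − d(x) − d(y)), contradicting the degree condition.

module Submission where

open import Defs hiding (sym)
open import Data.Bool using (Bool; true; false; if_then_else_; not)
import Data.Bool as Bool
open import Data.Bool.Properties using (∨-comm)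
open import Data.Empty using (⊥-elim)
open import Data.Fin using (Fin; zero; suc; toℕ; fromℕ; fromℕ<)
open import Data.Fin.Permutation using (transpose)
import Data.Fin.Permutation.Components as Perm
open import Data.Fin.Properties using (_≟_; any?; suc-injective; toℕ-fromℕ<; toℕ-fromℕ)
open import Data.List using (List; []; _∷_; _++_; tabulate)
import Data.List
open import Data.List.Relation.Unary.All as All using (All; []; _∷_)
open import Data.List.Relation.Unary.AllPairs using ([]; _∷_)
open import Data.List.Relation.Unary.Unique.Propositional using (Unique)
open import Data.Nat using (ℕ; zero; suc; _+_; _*_; _∸_; _≤_; _<_; z≤n; s≤s; NonZero)
import Data.Nat as ℕ
open import Data.Nat.Induction using (<-wellFounded)
import Data.Nat.ListAction
open import Data.Nat.Properties hiding (_≟_; suc-injective)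
open import Data.Nat.Tactic.RingSolver using (solve-∀)
open import Algebra.Properties.Semiring.Sum +-*-semiring
open import Data.Product using (Σ; _×_; _,_; ∃-syntax; proj₁; proj₂; map₁)
open import Data.Sum using (_⊎_; inj₁; inj₂; [_,_])
import Data.Sum as Sum
open import Function using (_∘_; _$_; _⇔_; mk⇔; Equivalence)
import Function.Properties.Equivalence as ⇔
open import Induction.WellFounded using (Acc; acc)
open import Relation.Binary.PropositionalEquality
  using (_≡_; _≢_; refl; sym; trans; cong; cong₂; subst; subst₂; module ≡-Reasoning)
open import Relation.Nullary using (¬_; Dec; yes; no; does; ¬?; contradiction)
open import Relation.Nullary.Decidable
  using (_×-dec_; _⊎-dec_; dec-true; dec-false; does-⇔; toSum; decidable-stable)

private
  variable
    A P Q : Set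

bit : Bool → ℕ
bit b = if b then 1 else 0

𝟙 : Dec P → ℕ
𝟙 d = bit (does d)

𝟙-yes : (d : Dec P) → P → 𝟙 d ≡ 1
𝟙-yes d p = cong bit (dec-true d p)

𝟙-no : (d : Dec P) → ¬ P → 𝟙 d ≡ 0
𝟙-no d ¬p = cong bit (dec-false d ¬p)

𝟙-cong : (d : Dec P) (e : Dec Q) → P ⇔ Q → 𝟙 d ≡ 𝟙 e
𝟙-cong d e P⇔Q = cong bit (does-⇔ P⇔Q d e)

𝟙≤1 : (d : Dec P) → 𝟙 d ≤ 1
𝟙≤1 (yes _) = s≤s z≤n
𝟙≤1 (no _) = z≤n

does⇒ : (d : Dec P) → does d ≡ true → P
does⇒ (yes p) _ = p

if-yes : (d : Dec P) {x y : A} → P → (if does d then x else y) ≡ x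
if-yes d p = cong (if_then _ else _) (dec-true d p)

if-no : (d : Dec P) {x y : A} → ¬ P → (if does d then x else y) ≡ y
if-no d ¬p = cong (if_then _ else _) (dec-false d ¬p)

𝟙-⊎ : (d : Dec P) (e : Dec Q) → ¬ (P × Q) → 𝟙 (d ⊎-dec e) ≡ 𝟙 d + 𝟙 e
𝟙-⊎ (yes p) (yes q) ¬pq = ⊥-elim (¬pq (p , q))
𝟙-⊎ (yes _) (no _) _ = refl
𝟙-⊎ (no _) (yes _) _ = refl
𝟙-⊎ (no _) (no _) _ = refl

δ : ∀ {n} → Fin n → Fin n → ℕ
δ a b = 𝟙 (a ≟ b)

∑-mono-≤ : ∀ {n} {f g : Fin n → ℕ} → (∀ i → f i ≤ g i) → sum f ≤ sum g
∑-mono-≤ {zero} f≤g = z≤n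
∑-mono-≤ {suc n} f≤g = +-mono-≤ (f≤g zero) (∑-mono-≤ (λ i → f≤g (suc i)))

∑-const : ∀ n c → ∑[ i < n ] c ≡ n * c
∑-const zero c = refl
∑-const (suc n) c = cong (c +_) (∑-const n c)

∑-zero : ∀ {n} {f : Fin n → ℕ} → (∀ i → f i ≡ 0) → sum f ≡ 0
∑-zero {n} f≗0 = trans (sum-cong-≗ f≗0) (trans (∑-const n 0) (*-zeroʳ n))

≤-∑ : ∀ {n} (f : Fin n → ℕ) i → f i ≤ sum f
≤-∑ f zero = m≤m+n _ _
≤-∑ f (suc i) = ≤-trans (≤-∑ (λ j → f (suc j)) i) (m≤n+m _ (f zero))

∑-update : ∀ {n} (a : Fin n) (f g : Fin n → ℕ) → (∀ w → w ≢ a → f w ≡ g w) →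
           sum f + g a ≡ sum g + f a
∑-update zero f g f≗g = begin
  f zero + sum (λ i → f (suc i)) + g zero
    ≡⟨ cong (λ s → f zero + s + g zero) (sum-cong-≗ (λ i → f≗g (suc i) λ ())) ⟩
  f zero + sum (λ i → g (suc i)) + g zero
    ≡⟨ swap (f zero) (sum (λ i → g (suc i))) (g zero) ⟩
  g zero + sum (λ i → g (suc i)) + f zero ∎
  where
  open ≡-Reasoning
  swap : ∀ x s y → x + s + y ≡ y + s + x
  swap = solve-∀
∑-update (suc a) f g f≗g = begin
  f zero + sum (λ i → f (suc i)) + g (suc a)
    ≡⟨ +-assoc (f zero) _ _ ⟩
  f zero + (sum (λ i → f (suc i)) + g (suc a))
    ≡⟨ cong₂ _+_ (f≗g zero λ ())
         (∑-update a (λ i → f (suc i)) (λ i → g (suc i)) (λ w w≢a → f≗g (suc w) (w≢a ∘ suc-injective))) ⟩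
  g zero + (sum (λ i → g (suc i)) + f (suc a))
    ≡⟨ +-assoc (g zero) _ _ ⟨
  g zero + sum (λ i → g (suc i)) + f (suc a) ∎
  where open ≡-Reasoning

∑-update₂ : ∀ {n} {a b : Fin n} (f g : Fin n → ℕ) → a ≢ b → (∀ w → w ≢ a → w ≢ b → f w ≡ g w) →
            sum f + (g a + g b) ≡ sum g + (f a + f b)
∑-update₂ {a = a} {b} f g a≢b f≗g = begin
  sum f + (g a + g b)   ≡⟨ +-assoc (sum f) _ _ ⟨
  sum f + g a + g b     ≡⟨ cong (_+ g b) (trans (cong (sum f +_) (sym ka)) (∑-update a f k f≗k)) ⟩
  sum k + f a + g b     ≡⟨ +-assoc (sum k) _ _ ⟩
  sum k + (f a + g b)   ≡⟨ cong (sum k +_) (+-comm (f a) (g b)) ⟩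
  sum k + (g b + f a)   ≡⟨ +-assoc (sum k) _ _ ⟨
  sum k + g b + f a     ≡⟨ cong (_+ f a) (trans (∑-update b k g k≗g) (cong (sum g +_) kb)) ⟩
  sum g + f b + f a     ≡⟨ +-assoc (sum g) _ _ ⟩
  sum g + (f b + f a)   ≡⟨ cong (sum g +_) (+-comm (f b) (f a)) ⟩
  sum g + (f a + f b)   ∎
  where
  open ≡-Reasoning
  k : Fin _ → ℕ
  k w = if does (w ≟ a) then g w else f w
  ka : k a ≡ g a
  ka = if-yes (a ≟ a) refl
  kb : k b ≡ f b
  kb = if-no (b ≟ a) (a≢b ∘ sym)
  f≗k : ∀ w → w ≢ a → f w ≡ k w
  f≗k w w≢a = sym (if-no (w ≟ a) w≢a)
  k≗g : ∀ w → w ≢ b → k w ≡ g w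
  k≗g w w≢b with w ≟ a
  ... | yes _ = refl
  ... | no w≢a = f≗g w w≢a w≢b

∑-supported : ∀ {n} (a : Fin n) (f : Fin n → ℕ) → (∀ w → w ≢ a → f w ≡ 0) → sum f ≡ f a
∑-supported {n} a f f≗0 = +-cancelʳ-≡ 0 _ _ (begin
  sum f + 0                  ≡⟨ ∑-update a f (λ _ → 0) f≗0 ⟩
  ∑[ w < n ] 0 + f a         ≡⟨ cong (_+ f a) (∑-zero {n} {λ _ → 0} λ _ → refl) ⟩
  f a                        ≡⟨ +-identityʳ (f a) ⟨
  f a + 0                    ∎)
  where open ≡-Reasoning

∑-δ : ∀ {n} (a : Fin n) → ∑[ w < n ] δ a w ≡ 1
∑-δ a = trans (∑-supported a (δ a) (λ w w≢a → 𝟙-no (a ≟ w) (w≢a ∘ sym))) (𝟙-yes (a ≟ a) refl)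

∑-δ-* : ∀ {n} (a : Fin n) (f : Fin n → ℕ) → ∑[ w < n ] (δ a w * f w) ≡ f a
∑-δ-* a f = begin
  sum (λ w → δ a w * f w) ≡⟨ ∑-supported a _ (λ w w≢a → cong (_* f w) (𝟙-no (a ≟ w) (w≢a ∘ sym))) ⟩
  δ a a * f a             ≡⟨ cong (_* f a) (𝟙-yes (a ≟ a) refl) ⟩
  1 * f a                 ≡⟨ *-identityˡ (f a) ⟩
  f a                     ∎
  where open ≡-Reasoning

∑-fibres-≤ : ∀ {n} (p : Fin n → Fin n) (c f : Fin n → ℕ) (R : ℕ) →
             (∀ w → ∑[ z < n ] (δ (p z) w * c z) ≤ R) →
             ∑[ z < n ] (c z * f (p z)) ≤ R * sum f
∑-fibres-≤ {n} p c f R fibre≤R = begin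
  ∑[ z < n ] (c z * f (p z))
    ≡⟨ sum-cong-≗ (sym ∘ point) ⟩
  ∑[ z < n ] ∑[ w < n ] (δ (p z) w * c z * f w)
    ≡⟨ ∑-comm (λ z w → δ (p z) w * c z * f w) ⟩
  ∑[ w < n ] ∑[ z < n ] (δ (p z) w * c z * f w)
    ≡⟨ sum-cong-≗ (λ w → *-distribʳ-sum (f w) (λ z → δ (p z) w * c z)) ⟨
  ∑[ w < n ] (∑[ z < n ] (δ (p z) w * c z) * f w)
    ≤⟨ ∑-mono-≤ (λ w → *-monoˡ-≤ (f w) (fibre≤R w)) ⟩
  ∑[ w < n ] (R * f w)
    ≡⟨ *-distribˡ-sum R f ⟨
  R * sum f
    ∎
  where
  open ≤-Reasoning
  point : ∀ z → ∑[ w < n ] (δ (p z) w * c z * f w) ≡ c z * f (p z)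
  point z = trans (sum-cong-≗ (λ w → *-assoc (δ (p z) w) (c z) (f w))) (∑-δ-* (p z) (λ w → c z * f w))

count-tabulate : ∀ {n} (q : A → Bool) (f : Fin n → A) →
                 count q (tabulate f) ≡ ∑[ i < n ] bit (q (f i))
count-tabulate {n = zero} q f = refl
count-tabulate {n = suc n} q f = cong (bit (q (f zero)) +_) (count-tabulate q (f ∘ suc))

sumFin≡∑ : ∀ {n} (d : Fin n → ℕ) → sumFin d ≡ sum d
sumFin≡∑ {n} d = go (λ i → i)
  where
  go : ∀ {m} (f : Fin m → Fin n) → Data.Nat.ListAction.sum (Data.List.map d (tabulate f)) ≡ ∑[ i < m ] d (f i)
  go {zero} f = refl
  go {suc m} f = cong (d (f zero) +_) (go (f ∘ suc))

transpose-ˡ : ∀ {n} (i j : Fin n) → Perm.transpose i j i ≡ j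
transpose-ˡ i j with i ≟ i
... | yes _ = refl
... | no i≢i = ⊥-elim (i≢i refl)

transpose-ʳ : ∀ {n} (i j : Fin n) → Perm.transpose i j j ≡ i
transpose-ʳ i j with j ≟ i
... | yes j≡i = j≡i
... | no _ with j ≟ j
...   | yes _ = refl
...   | no j≢j = ⊥-elim (j≢j refl)

transpose-fix : ∀ {n} {i j k : Fin n} → k ≢ i → k ≢ j → Perm.transpose i j k ≡ k
transpose-fix {i = i} {j} {k} k≢i k≢j with k ≟ i
... | yes k≡i = ⊥-elim (k≢i k≡i)
... | no _ with k ≟ j
...   | yes k≡j = ⊥-elim (k≢j k≡j)
...   | no _ = refl

transpose-involutive : ∀ {n} (i j k : Fin n) → Perm.transpose i j (Perm.transpose i j k) ≡ k
transpose-involutive i j k = cases (k ≟ i) (k ≟ j)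
  where
  τ = Perm.transpose i j
  cases : Dec (k ≡ i) → Dec (k ≡ j) → τ (τ k) ≡ k
  cases (yes k≡i) _ = begin
    τ (τ k) ≡⟨ cong (τ ∘ τ) k≡i ⟩
    τ (τ i) ≡⟨ cong τ (transpose-ˡ i j) ⟩
    τ j     ≡⟨ transpose-ʳ i j ⟩
    i       ≡⟨ k≡i ⟨
    k       ∎
    where open ≡-Reasoning
  cases (no _) (yes k≡j) = begin
    τ (τ k) ≡⟨ cong (τ ∘ τ) k≡j ⟩
    τ (τ j) ≡⟨ cong τ (transpose-ʳ i j) ⟩
    τ i     ≡⟨ transpose-ˡ i j ⟩
    j       ≡⟨ k≡j ⟨
    k       ∎
    where open ≡-Reasoning
  cases (no k≢i) (no k≢j) = trans (cong τ (transpose-fix k≢i k≢j)) (transpose-fix k≢i k≢j)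

iterate : (A → A) → ℕ → A → A
iterate f zero x = x
iterate f (suc k) x = iterate f k (f x)

iterate-+ : ∀ (f : A → A) j k x → iterate f (j + k) x ≡ iterate f k (iterate f j x)
iterate-+ f zero k x = refl
iterate-+ f (suc j) k x = iterate-+ f j k (f x)

iterate-fixed : ∀ (f : A → A) {x} → f x ≡ x → ∀ k → iterate f k x ≡ x
iterate-fixed f fx≡x zero = refl
iterate-fixed f fx≡x (suc k) = trans (cong (iterate f k) fx≡x) (iterate-fixed f fx≡x k)

iterate-closed : ∀ (f : A → A) (P : A → Set) → (∀ a → P a → P (f a)) →
                 ∀ k {x} → P x → P (iterate f k x)
iterate-closed f P closed zero Px = Px
iterate-closed f P closed (suc k) Px = iterate-closed f P closed k (closed _ Px)

headOr : List A → A → A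
headOr [] l = l
headOr (z ∷ _) l = z

lastOr : A → List A → A
lastOr a [] = a
lastOr a (z ∷ zs) = lastOr z zs

All-headOr : ∀ {P : A → Set} zs (l : A) → All P (zs ++ l ∷ []) → P (headOr zs l)
All-headOr [] l (Pl ∷ _) = Pl
All-headOr (z ∷ zs) l (Pz ∷ _) = Pz

All-last : ∀ {P : A → Set} zs (l : A) → All P (zs ++ l ∷ []) → P l
All-last [] l (Pl ∷ _) = Pl
All-last (z ∷ zs) l (_ ∷ Ps) = All-last zs l Ps

All-lastOr : ∀ {P : A → Set} a zs (l : A) → All P (a ∷ zs ++ l ∷ []) → P (lastOr a zs)
All-lastOr a [] l (Pa ∷ _) = Pa
All-lastOr a (z ∷ zs) l (_ ∷ Ps) = All-lastOr z zs l Ps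

module _ {n} {G : Graph n} where

  Walk-++ : ∀ {a b c} → Walk G a b → Walk G b c → Walk G a c
  Walk-++ here w = w
  Walk-++ (step a~b w₁) w₂ = step a~b (Walk-++ w₁ w₂)

  Chain-first : ∀ a zs l → Chain G (a ∷ zs ++ l ∷ []) → Adjacent G a (headOr zs l)
  Chain-first a [] l (cons a~l _) = a~l
  Chain-first a (z ∷ zs) l (cons a~z _) = a~z

  Chain-last : ∀ a zs l → Chain G (a ∷ zs ++ l ∷ []) → Adjacent G (lastOr a zs) l
  Chain-last a [] l (cons a~l _) = a~l
  Chain-last a (z ∷ zs) l (cons _ chain) = Chain-last z zs l chain

-- Rooted trees

record RootedTree (n : ℕ) : Set where
  field
    root         : Fin n
    parent       : Fin n → Fin n
    parent-root  : parent root ≡ root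
    reaches-root : ∀ v → ∃[ k ] iterate parent k v ≡ root

module Tree {n} (T : RootedTree n) where
  open RootedTree T public

  iterate-root : ∀ k → iterate parent k root ≡ root
  iterate-root = iterate-fixed parent parent-root

  fixed⇒root : ∀ {v} → parent v ≡ v → v ≡ root
  fixed⇒root {v} pv≡v = trans (sym (iterate-fixed parent pv≡v (proj₁ (reaches-root v)))) (proj₂ (reaches-root v))

  stays-root : ∀ {v j k} → iterate parent j v ≡ root → j ≤ k → iterate parent k v ≡ root
  stays-root {v} {j} {k} at-root j≤k = begin
    iterate parent k v                              ≡⟨ cong (λ m → iterate parent m v) (m+[n∸m]≡n j≤k) ⟨
    iterate parent (j + (k ∸ j)) v                  ≡⟨ iterate-+ parent j (k ∸ j) v ⟩
    iterate parent (k ∸ j) (iterate parent j v)     ≡⟨ cong (iterate parent (k ∸ j)) at-root ⟩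
    iterate parent (k ∸ j) root                     ≡⟨ iterate-root (k ∸ j) ⟩
    root                                            ∎
    where open ≡-Reasoning

  depthBound : ℕ
  depthBound = ∑[ v < n ] proj₁ (reaches-root v)

  reaches-root-within : ∀ v → iterate parent depthBound v ≡ root
  reaches-root-within v = stays-root (proj₂ (reaches-root v)) (≤-∑ (λ w → proj₁ (reaches-root w)) v)

  notRoot : Fin n → ℕ
  notRoot v = 𝟙 (¬? (v ≟ root))

  notRoot+δ : ∀ v → notRoot v + δ root v ≡ 1
  notRoot+δ v with toSum (v ≟ root)
  ... | inj₁ refl rewrite dec-true (v ≟ v) refl = refl
  ... | inj₂ v≢root rewrite dec-false (v ≟ root) v≢root | dec-false (root ≟ v) (v≢root ∘ sym) = refl

  nonRootSteps : ℕ → Fin n → ℕ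
  nonRootSteps zero v = 0
  nonRootSteps (suc k) v = notRoot v + nonRootSteps k (parent v)

  nonRootSteps-suc : ∀ k v → nonRootSteps (suc k) v ≡ nonRootSteps k v + notRoot (iterate parent k v)
  nonRootSteps-suc zero v = +-comm (notRoot v) 0
  nonRootSteps-suc (suc k) v =
    trans (cong (notRoot v +_) (nonRootSteps-suc k (parent v))) (sym (+-assoc (notRoot v) _ _))

  height : Fin n → ℕ
  height = nonRootSteps depthBound

  height-parent : ∀ {v} → v ≢ root → height v ≡ suc (height (parent v))
  height-parent {v} v≢root = begin
    height v                                          ≡⟨ +-identityʳ (height v) ⟨
    height v + 0                                      ≡⟨ cong (height v +_) end-at-root ⟨
    height v + notRoot (iterate parent depthBound v)  ≡⟨ nonRootSteps-suc depthBound v ⟨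
    notRoot v + height (parent v)                     ≡⟨ cong (_+ height (parent v)) (𝟙-yes (¬? (v ≟ root)) v≢root) ⟩
    suc (height (parent v))                           ∎
    where
    open ≡-Reasoning
    end-at-root : notRoot (iterate parent depthBound v) ≡ 0
    end-at-root = 𝟙-no (¬? (_ ≟ root)) (λ ¬at-root → ¬at-root (reaches-root-within v))

  ChildOf : Fin n → Fin n → Set
  ChildOf u v = u ≢ root × parent u ≡ v

  childOf? : ∀ u v → Dec (ChildOf u v)
  childOf? u v = ¬? (u ≟ root) ×-dec (parent u ≟ v)

  height-child : ∀ {u v} → ChildOf u v → height v < height u
  height-child (u≢root , refl) = ≤-reflexive (sym (height-parent u≢root))

  child-asym : ∀ {u v} → ChildOf u v → ¬ ChildOf v u
  child-asym u→v v→u = <-asym (height-child u→v) (height-child v→u)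

  child-irrefl : ∀ {v} → ¬ ChildOf v v
  child-irrefl (v≢root , pv≡v) = v≢root (fixed⇒root pv≡v)

  root-not-child : ∀ {v} → ¬ ChildOf root v
  root-not-child (root≢root , _) = root≢root refl

  Linked : Fin n → Fin n → Set
  Linked u v = ChildOf u v ⊎ ChildOf v u

  linked? : ∀ u v → Dec (Linked u v)
  linked? u v = childOf? u v ⊎-dec childOf? v u

  linked-to-root : ∀ {v} → Linked v root → ChildOf v root
  linked-to-root (inj₁ v→root) = v→root
  linked-to-root (inj₂ root→v) = ⊥-elim (root-not-child root→v)

  graph : Graph n
  graph = record
    { adj    = λ u v → does (linked? u v)
    ; sym    = λ u v → ∨-comm (does (childOf? u v)) (does (childOf? v u))
    ; irrefl = λ v → dec-false (linked? v v) λ { (inj₁ v→v) → child-irrefl v→v ; (inj₂ v→v) → child-irrefl v→v }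
    }

  adjacent⇔linked : ∀ {u v} → Adjacent graph u v ⇔ Linked u v
  adjacent⇔linked {u} {v} = mk⇔ (does⇒ (linked? u v)) (dec-true (linked? u v))

  walk-to-root : ∀ k u → iterate parent k u ≡ root → Walk graph u root
  walk-to-root zero u refl = here
  walk-to-root (suc k) u at-root with u ≟ root
  ... | yes refl = here
  ... | no u≢root = step (Equivalence.from adjacent⇔linked (inj₁ (u≢root , refl))) (walk-to-root k (parent u) at-root)

  walk-from-root : ∀ k u → iterate parent k u ≡ root → Walk graph root u
  walk-from-root zero u refl = here
  walk-from-root (suc k) u at-root with u ≟ root
  ... | yes refl = here
  ... | no u≢root = Walk-++ (walk-from-root k (parent u) at-root)
                            (step (Equivalence.from adjacent⇔linked (inj₂ (u≢root , refl))) here)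

  connected : Connected graph
  connected u v = Walk-++ (walk-to-root (proj₁ (reaches-root u)) u (proj₂ (reaches-root u)))
                          (walk-from-root (proj₁ (reaches-root v)) v (proj₂ (reaches-root v)))

  Path : List (Fin n) → Set
  Path vs = Unique vs × Chain graph vs

  linked-in : ∀ {a zs l} → Chain graph (a ∷ zs ++ l ∷ []) → Linked a (headOr zs l)
  linked-in {a} {zs} {l} chain = Equivalence.to adjacent⇔linked (Chain-first a zs l chain)

  linked-out : ∀ {a zs l} → Chain graph (a ∷ zs ++ l ∷ []) → Linked (lastOr a zs) l
  linked-out {a} {zs} {l} chain = Equivalence.to adjacent⇔linked (Chain-last a zs l chain)

  -- After a step down to a child the path can never step up again: from a child the only way
  -- up leads back to its parent, which the path has already visited.
  path-descends : ∀ a zs l → Path (a ∷ zs ++ l ∷ []) → ChildOf (headOr zs l) a →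
                  height a < height l × ChildOf l (lastOr a zs)
  path-descends a [] l _ l→a = height-child l→a , l→a
  path-descends a (z ∷ zs) l (a∉ ∷ unique , cons _ chain) z→a with linked-in {z} {zs} {l} chain
  ... | inj₁ z→next = ⊥-elim (All-headOr zs l (All.tail a∉) (trans (sym (proj₂ z→a)) (proj₂ z→next)))
  ... | inj₂ next→z = map₁ (<-trans (height-child z→a)) (path-descends z zs l (unique , chain) next→z)

  path-ascends : ∀ a zs l → Path (a ∷ zs ++ l ∷ []) → ChildOf (lastOr a zs) l → height l < height a
  path-ascends a [] l _ a→l = height-child a→l
  path-ascends a (z ∷ zs) l path@(_ ∷ unique , cons _ chain) last→l with linked-in {a} {z ∷ zs} {l} (proj₂ path)
  ... | inj₁ a→z = <-trans (path-ascends z zs l (unique , chain) last→l) (height-child a→z)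
  ... | inj₂ z→a = ⊥-elim (child-asym last→l (proj₂ (path-descends a (z ∷ zs) l path z→a)))

  acyclic : ¬ HasCycle graph
  acyclic (x , [] , y , () , _)
  acyclic (x , c ∷ cs , y , _ , unique@(_ ∷ c∉ ∷ _) , chain , y~x) with Equivalence.to adjacent⇔linked y~x
  ... | inj₂ x→y with linked-in {x} {c ∷ cs} {y} chain
  ...   | inj₁ x→c = All-last cs y c∉ (trans (sym (proj₂ x→c)) (proj₂ x→y))
  ...   | inj₂ c→x = <-asym (proj₁ (path-descends x (c ∷ cs) y (unique , chain) c→x)) (height-child x→y)
  acyclic (x , c ∷ cs , y , _ , unique@(x∉ ∷ _) , chain , y~x) | inj₁ y→x with linked-out {x} {c ∷ cs} {y} chain
  ...   | inj₁ last→y = <-asym (path-ascends x (c ∷ cs) y (unique , chain) last→y) (height-child y→x)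
  ...   | inj₂ y→last = All-lastOr c cs y x∉ (trans (sym (proj₂ y→x)) (proj₂ y→last))

  isTree : IsTree graph
  isTree = connected , acyclic

  children : Fin n → ℕ
  children v = ∑[ w < n ] 𝟙 (childOf? w v)

  degree : Fin n → ℕ
  degree v = notRoot v + children v

  ∑-linked : ∀ v → ∑[ w < n ] 𝟙 (linked? v w) ≡ degree v
  ∑-linked v = begin
    ∑[ w < n ] 𝟙 (linked? v w)
      ≡⟨ sum-cong-≗ (λ w → 𝟙-⊎ (childOf? v w) (childOf? w v) (λ (v→w , w→v) → child-asym v→w w→v)) ⟩
    ∑[ w < n ] (𝟙 (childOf? v w) + 𝟙 (childOf? w v))
      ≡⟨ ∑-distrib-+ (λ w → 𝟙 (childOf? v w)) (λ w → 𝟙 (childOf? w v)) ⟩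
    ∑[ w < n ] 𝟙 (childOf? v w) + children v
      ≡⟨ cong (_+ children v) up ⟩
    degree v
      ∎
    where
    open ≡-Reasoning
    up : ∑[ w < n ] 𝟙 (childOf? v w) ≡ notRoot v
    up = trans (∑-supported (parent v) _ (λ w w≢pv → 𝟙-no (childOf? v w) (λ (_ , pv≡w) → w≢pv (sym pv≡w))))
               (𝟙-cong (childOf? v (parent v)) (¬? (v ≟ root)) (mk⇔ proj₁ (_, refl)))

  deg-graph : ∀ v → deg graph v ≡ degree v
  deg-graph v = trans (count-tabulate (λ w → does (linked? v w)) (λ w → w)) (∑-linked v)

  Descendant : Fin n → Fin n → Set
  Descendant c z = ∃[ j ] iterate parent j z ≡ c

  -- The search is bounded because after depthBound steps every vertex has reached the root.
  descendant? : ∀ c z → Dec (Descendant c z)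
  descendant? c z with any? (λ (j : Fin (suc depthBound)) → iterate parent (toℕ j) z ≟ c)
  ... | yes (j , reaches) = yes (toℕ j , reaches)
  ... | no ¬reaches = no λ (j , reaches) → ¬reaches (bounded j reaches)
    where
    bounded : ∀ j → iterate parent j z ≡ c → ∃[ i ] iterate parent (toℕ i) z ≡ c
    bounded j reaches with j ≤? depthBound
    ... | yes j≤N = fromℕ< (s≤s j≤N) , subst (λ m → iterate parent m z ≡ c) (sym (toℕ-fromℕ< (s≤s j≤N))) reaches
    ... | no j≰N = fromℕ depthBound , subst (λ m → iterate parent m z ≡ c) (sym (toℕ-fromℕ depthBound)) reaches-at-N
      where
      c≡root : c ≡ root
      c≡root = trans (sym reaches) (stays-root (reaches-root-within z) (<⇒≤ (≰⇒> j≰N)))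
      reaches-at-N : iterate parent depthBound z ≡ c
      reaches-at-N = trans (reaches-root-within z) (sym c≡root)

  descendant-refl : ∀ c → Descendant c c
  descendant-refl c = 0 , refl

  descendant-child : ∀ {c z} → Descendant c (parent z) → Descendant c z
  descendant-child (j , reaches) = suc j , reaches

  descendant-parent : ∀ {c z} → z ≢ c → Descendant c z → Descendant c (parent z)
  descendant-parent z≢c (zero , z≡c) = ⊥-elim (z≢c z≡c)
  descendant-parent z≢c (suc j , reaches) = j , reaches

  root-not-descendant : ∀ {c} → c ≢ root → ¬ Descendant c root
  root-not-descendant c≢root (j , reaches) = c≢root (trans (sym reaches) (iterate-root j))

SameEdges : ∀ {n} → RootedTree n → RootedTree n → Set
SameEdges T T′ = ∀ u v → Tree.Linked T u v ⇔ Tree.Linked T′ u v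

degree-sameEdges : ∀ {n} (T T′ : RootedTree n) → SameEdges T T′ → ∀ v → Tree.degree T′ v ≡ Tree.degree T v
degree-sameEdges {n} T T′ same v = begin
  Tree.degree T′ v
    ≡⟨ Tree.∑-linked T′ v ⟨
  ∑[ w < n ] 𝟙 (Tree.linked? T′ v w)
    ≡⟨ sum-cong-≗ (λ w → 𝟙-cong (Tree.linked? T′ v w) (Tree.linked? T v w) (⇔.sym (same v w))) ⟩
  ∑[ w < n ] 𝟙 (Tree.linked? T v w)
    ≡⟨ Tree.∑-linked T v ⟩
  Tree.degree T v
    ∎
  where open ≡-Reasoning

children-transpose : ∀ {n} (T T′ : RootedTree n) (a b : Fin n) {v v′} →
                     (∀ w → Tree.ChildOf T′ w v ⇔ Tree.ChildOf T (Perm.transpose a b w) v′) →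
                     Tree.children T′ v ≡ Tree.children T v′
children-transpose {n} T T′ a b {v} {v′} child⇔ = begin
  ∑[ w < n ] 𝟙 (Tree.childOf? T′ w v)
    ≡⟨ sum-cong-≗ (λ w → 𝟙-cong (Tree.childOf? T′ w v) (Tree.childOf? T _ v′) (child⇔ w)) ⟩
  ∑[ w < n ] 𝟙 (Tree.childOf? T (Perm.transpose a b w) v′)
    ≡⟨ ∑-permute (λ w → 𝟙 (Tree.childOf? T w v′)) (transpose a b) ⟨
  ∑[ w < n ] 𝟙 (Tree.childOf? T w v′)
    ∎
  where open ≡-Reasoning

-- A rooted tree with prescribed degrees

DegreeRealisation : ∀ {n} → (Fin n → ℕ) → Set
DegreeRealisation {n} d = Σ (RootedTree n) λ T → ∀ v → Tree.degree T v ≡ d v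

module Relabel {n} (T : RootedTree n) (a b : Fin n) where
  open Tree T

  τ : Fin n → Fin n
  τ = Perm.transpose a b

  τ-flip : ∀ {u v} → τ u ≡ v ⇔ u ≡ τ v
  τ-flip {u} {v} = mk⇔ (λ τu≡v → trans (sym (transpose-involutive a b u)) (cong τ τu≡v))
                       (λ u≡τv → trans (cong τ u≡τv) (transpose-involutive a b v))

  ≢-flip : ∀ {u v} → u ≢ τ v ⇔ τ u ≢ v
  ≢-flip = mk⇔ (λ u≢τv τu≡v → u≢τv (Equivalence.to τ-flip τu≡v))
               (λ τu≢v u≡τv → τu≢v (Equivalence.from τ-flip u≡τv))

  parent′ : Fin n → Fin n
  parent′ w = τ (parent (τ w))

  iterate-parent′ : ∀ k w → iterate parent′ k w ≡ τ (iterate parent k (τ w))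
  iterate-parent′ zero w = sym (transpose-involutive a b w)
  iterate-parent′ (suc k) w =
    trans (iterate-parent′ k (parent′ w)) (cong (τ ∘ iterate parent k) (transpose-involutive a b (parent (τ w))))

  relabelled : RootedTree n
  relabelled = record
    { root         = τ root
    ; parent       = parent′
    ; parent-root  = cong τ (trans (cong parent (transpose-involutive a b root)) parent-root)
    ; reaches-root = λ w → let (k , reaches) = reaches-root (τ w) in
                           k , trans (iterate-parent′ k w) (cong τ reaches)
    }

  degree-relabelled : ∀ v → Tree.degree relabelled v ≡ degree (τ v)
  degree-relabelled v = cong₂ _+_
    (𝟙-cong (¬? (v ≟ τ root)) (¬? (τ v ≟ root)) ≢-flip)
    (children-transpose T relabelled a b λ w → mk⇔
      (λ (w≢τroot , τpτw≡v) → Equivalence.to ≢-flip w≢τroot , Equivalence.to τ-flip τpτw≡v)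
      (λ (τw≢root , pτw≡τv) → Equivalence.from ≢-flip τw≢root , Equivalence.from τ-flip pτw≡τv))

module Extend {k} (T : RootedTree k) (b : Fin k) where
  open Tree T

  parent⁺ : Fin (suc k) → Fin (suc k)
  parent⁺ zero = suc b
  parent⁺ (suc v) = suc (parent v)

  iterate-parent⁺ : ∀ j v → iterate parent⁺ j (suc v) ≡ suc (iterate parent j v)
  iterate-parent⁺ zero v = refl
  iterate-parent⁺ (suc j) v = iterate-parent⁺ j (parent v)

  extended : RootedTree (suc k)
  extended = record
    { root         = suc root
    ; parent       = parent⁺
    ; parent-root  = cong suc parent-root
    ; reaches-root = reaches
    }
    where
    reaches : ∀ w → ∃[ j ] iterate parent⁺ j w ≡ suc root
    reaches zero = let (j , reaches-b) = reaches-root b in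
                   suc j , trans (iterate-parent⁺ j b) (cong suc reaches-b)
    reaches (suc v) = let (j , reaches-v) = reaches-root v in
                      j , trans (iterate-parent⁺ j v) (cong suc reaches-v)

  degree-new : Tree.degree extended zero ≡ 1
  degree-new = cong suc (∑-zero no-child)
    where
    no-child : ∀ i → 𝟙 (Tree.childOf? extended (suc i) zero) ≡ 0
    no-child i = 𝟙-no (Tree.childOf? extended (suc i) zero) λ ()

  notRoot-old : ∀ v → Tree.notRoot extended (suc v) ≡ notRoot v
  notRoot-old v = 𝟙-cong (¬? (suc v ≟ suc root)) (¬? (v ≟ root))
    (mk⇔ (λ sv≢sr v≡r → sv≢sr (cong suc v≡r)) (λ v≢r sv≡sr → v≢r (suc-injective sv≡sr)))

  new-child : ∀ v → 𝟙 (Tree.childOf? extended zero (suc v)) ≡ δ b v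
  new-child v = 𝟙-cong (Tree.childOf? extended zero (suc v)) (b ≟ v)
    (mk⇔ (λ (_ , sb≡sv) → suc-injective sb≡sv) (λ b≡v → (λ ()) , cong suc b≡v))

  old-child : ∀ i v → 𝟙 (Tree.childOf? extended (suc i) (suc v)) ≡ 𝟙 (childOf? i v)
  old-child i v = 𝟙-cong (Tree.childOf? extended (suc i) (suc v)) (childOf? i v)
    (mk⇔ (λ (si≢sr , spi≡sv) → (λ i≡r → si≢sr (cong suc i≡r)) , suc-injective spi≡sv)
         (λ (i≢r , pi≡v) → (λ si≡sr → i≢r (suc-injective si≡sr)) , cong suc pi≡v))

  degree-old : ∀ v → Tree.degree extended (suc v) ≡ degree v + δ b v
  degree-old v = begin
    Tree.degree extended (suc v)
      ≡⟨ cong₂ (λ p q → p + (q + oldChildren)) (notRoot-old v) (new-child v) ⟩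
    notRoot v + (δ b v + oldChildren)
      ≡⟨ cong (λ c → notRoot v + (δ b v + c)) (sum-cong-≗ (λ i → old-child i v)) ⟩
    notRoot v + (δ b v + children v)
      ≡⟨ rearrange (notRoot v) (δ b v) (children v) ⟩
    notRoot v + children v + δ b v
      ∎
    where
    open ≡-Reasoning
    oldChildren = ∑[ i < k ] 𝟙 (Tree.childOf? extended (suc i) (suc v))
    rearrange : ∀ p q r → p + (q + r) ≡ p + r + q
    rearrange = solve-∀

leaf-exists : ∀ {n} (d : Fin n → ℕ) → (∀ i → 1 ≤ d i) → sum d < 2 * n → ∃[ a ] d a ≡ 1
leaf-exists {n} d positive small with any? (λ i → d i ℕ.≟ 1)
... | yes found = found
... | no none = contradiction small (≤⇒≯ (begin
  2 * n          ≡⟨ *-comm 2 n ⟩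
  n * 2          ≡⟨ ∑-const n 2 ⟨
  ∑[ i < n ] 2   ≤⟨ ∑-mono-≤ at-least-2 ⟩
  sum d          ∎))
  where
  open ≤-Reasoning
  at-least-2 : ∀ i → 2 ≤ d i
  at-least-2 i with d i in di≡ | positive i
  ... | suc zero | _ = ⊥-elim (none (i , di≡))
  ... | suc (suc _) | _ = s≤s (s≤s z≤n)

branch-exists : ∀ {n} (d : Fin n → ℕ) → n < sum d → ∃[ b ] 2 ≤ d b
branch-exists {n} d large with any? (λ i → 2 ℕ.≤? d i)
... | yes found = found
... | no none = contradiction large (≤⇒≯ (begin
  sum d          ≤⟨ ∑-mono-≤ at-most-1 ⟩
  ∑[ i < n ] 1   ≡⟨ ∑-const n 1 ⟩
  n * 1          ≡⟨ *-identityʳ n ⟩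
  n              ∎))
  where
  open ≤-Reasoning
  at-most-1 : ∀ i → d i ≤ 1
  at-most-1 i = ≤-pred (≰⇒> λ 2≤di → none (i , 2≤di))

double-suc : ∀ m → 2 * suc m ≡ 2 * m + 2
double-suc = solve-∀

double-2+ : ∀ m → 2 * suc (suc m) ≡ 4 + (m + m)
double-2+ = solve-∀

attach-leaf : ∀ m (d : Fin (suc (suc (suc m))) → ℕ) → (∀ i → 1 ≤ d i) → sum d ≡ 2 * suc (suc m) →
              d zero ≡ 1 → ∀ b → 2 ≤ d (suc b) →
              (∀ (d₂ : Fin (suc (suc m)) → ℕ) → (∀ i → 1 ≤ d₂ i) → sum d₂ ≡ 2 * suc m →
                DegreeRealisation d₂) →
              DegreeRealisation d
attach-leaf m d positive sum≡ leaf b branch realise = Extend.extended T₂ b , degrees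
  where
  d₂ : Fin (suc (suc m)) → ℕ
  d₂ i = d (suc i) ∸ δ b i

  restore : ∀ i → d₂ i + δ b i ≡ d (suc i)
  restore i = m∸n+n≡m (≤-trans (𝟙≤1 (b ≟ i)) (positive (suc i)))

  d₂-positive : ∀ i → 1 ≤ d₂ i
  d₂-positive i with toSum (b ≟ i)
  ... | inj₁ refl = subst (λ e → 1 ≤ d (suc i) ∸ e) (sym (𝟙-yes (i ≟ i) refl)) (∸-monoˡ-≤ 1 branch)
  ... | inj₂ b≢i = subst (λ e → 1 ≤ d (suc i) ∸ e) (sym (𝟙-no (b ≟ i) b≢i)) (positive (suc i))

  sum-d₂ : sum d₂ ≡ 2 * suc m
  sum-d₂ = +-cancelʳ-≡ 2 _ _ (begin
    sum d₂ + 2                         ≡⟨ cong (λ e → sum d₂ + (e + 1)) leaf ⟨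
    sum d₂ + (d zero + 1)              ≡⟨ rearrange (sum d₂) (d zero) 1 ⟩
    d zero + (sum d₂ + 1)              ≡⟨ cong (λ e → d zero + (sum d₂ + e)) (∑-δ b) ⟨
    d zero + (sum d₂ + sum (δ b))      ≡⟨ cong (d zero +_) (∑-distrib-+ d₂ (δ b)) ⟨
    d zero + ∑[ i < _ ] (d₂ i + δ b i) ≡⟨ cong (d zero +_) (sum-cong-≗ restore) ⟩
    sum d                              ≡⟨ sum≡ ⟩
    2 * suc (suc m)                    ≡⟨ double-suc (suc m) ⟩
    2 * suc m + 2                      ∎)
    where
    open ≡-Reasoning
    rearrange : ∀ s a c → s + (a + c) ≡ a + (s + c)
    rearrange = solve-∀

  realisation₂ = realise d₂ d₂-positive sum-d₂
  T₂ = proj₁ realisation₂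
  degrees₂ = proj₂ realisation₂

  degrees : ∀ v → Tree.degree (Extend.extended T₂ b) v ≡ d v
  degrees zero = trans (Extend.degree-new T₂ b) (sym leaf)
  degrees (suc v) = trans (Extend.degree-old T₂ b v) (trans (cong (_+ δ b v) (degrees₂ v)) (restore v))

tree-with-degrees : ∀ m (d : Fin (suc (suc m)) → ℕ) → (∀ i → 1 ≤ d i) → sum d ≡ 2 * suc m → DegreeRealisation d
tree-with-degrees zero d positive sum≡ = edge , degrees
  where
  edge : RootedTree 2
  edge = record
    { root = zero ; parent = λ _ → zero ; parent-root = refl
    ; reaches-root = λ { zero → 0 , refl ; (suc zero) → 1 , refl } }
  both-leaves : ∀ x y → 1 ≤ x → 1 ≤ y → x + (y + 0) ≡ 2 → x ≡ 1 × y ≡ 1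
  both-leaves (suc zero) (suc zero) _ _ _ = refl , refl
  both-leaves (suc zero) (suc (suc _)) _ _ ()
  both-leaves (suc (suc x)) (suc y) _ _ sum≡2 = contradiction (cong (ℕ.pred ∘ ℕ.pred) sum≡2) (m+1+n≢0 x)
  degrees : ∀ v → Tree.degree edge v ≡ d v
  degrees zero = sym (proj₁ (both-leaves _ _ (positive zero) (positive (suc zero)) sum≡))
  degrees (suc zero) = sym (proj₂ (both-leaves _ _ (positive zero) (positive (suc zero)) sum≡))
tree-with-degrees (suc m) d positive sum≡ =
  Relabel.relabelled T₁ zero a , λ v → trans (Relabel.degree-relabelled T₁ zero a v)
                                            (trans (degrees₁ (τ v)) (cong d (transpose-involutive zero a v)))
  where
  sum-small : sum d < 2 * suc (suc (suc m))
  sum-small = subst₂ _<_ (sym sum≡) (sym (double-suc (suc (suc m)))) (m<m+n _ (s≤s z≤n))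
  sum-large : suc (suc (suc m)) < sum d
  sum-large = subst (suc (suc (suc m)) <_) (sym (trans sum≡ (double-2+ m))) (s≤s (s≤s (s≤s (s≤s (m≤m+n m m)))))
  leaf = leaf-exists d positive sum-small
  branch = branch-exists d sum-large
  a = proj₁ leaf
  τ = Perm.transpose zero a
  d′ : Fin (suc (suc (suc m))) → ℕ
  d′ = d ∘ τ
  d′-leaf : d′ zero ≡ 1
  d′-leaf = trans (cong d (transpose-ˡ zero a)) (proj₂ leaf)
  grow : ∀ i → 2 ≤ d′ i → DegreeRealisation d′
  grow zero 2≤d′ = contradiction (subst (2 ≤_) d′-leaf 2≤d′) λ { (s≤s ()) }
  grow (suc b) 2≤d′ = attach-leaf m d′ (positive ∘ τ)
    (trans (sym (∑-permute d (transpose zero a))) sum≡) d′-leaf b 2≤d′ (tree-with-degrees m)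
  realisation₁ = grow (τ (proj₁ branch))
                      (subst (λ i → 2 ≤ d i) (sym (transpose-involutive zero a _)) (proj₂ branch))
  T₁ = proj₁ realisation₁
  degrees₁ = proj₂ realisation₁

-- Moving tree edges into G

adjacent? : ∀ {n} (G : Graph n) u v → Dec (Adjacent G u v)
adjacent? G u v = adj G u v Bool.≟ true

nonAdjacent? : ∀ {n} (G : Graph n) u v → Dec (¬ Adjacent G u v)
nonAdjacent? G u v = ¬? (adjacent? G u v)

𝟙-nonAdjacent-sym : ∀ {n} (G : Graph n) u v → 𝟙 (nonAdjacent? G u v) ≡ 𝟙 (nonAdjacent? G v u)
𝟙-nonAdjacent-sym G u v = cong (λ b → 𝟙 (¬? (b Bool.≟ true))) (Graph.sym G u v)

¬adjacent-sym : ∀ {n} (G : Graph n) {u v} → ¬ Adjacent G u v → ¬ Adjacent G v u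
¬adjacent-sym G {u} {v} ¬u~v v~u = ¬u~v (trans (Graph.sym G u v) v~u)

Stray : ∀ {n} → Graph n → RootedTree n → Fin n → Set
Stray G T w = w ≢ Tree.root T × ¬ Adjacent G w (Tree.parent T w)

stray? : ∀ {n} (G : Graph n) (T : RootedTree n) w → Dec (Stray G T w)
stray? G T w = ¬? (w ≟ Tree.root T) ×-dec nonAdjacent? G w (Tree.parent T w)

-- A tree edge is counted at its lower endpoint: this is the number of tree edges outside G.
defect : ∀ {n} → Graph n → RootedTree n → ℕ
defect G T = ∑[ w < _ ] 𝟙 (stray? G T w)

module _ {n} (G : Graph n) (T : RootedTree n) where
  open Tree T

  𝟙-stray-root : 𝟙 (stray? G T root) ≡ 0
  𝟙-stray-root = 𝟙-no (stray? G T root) (λ (root≢root , _) → root≢root refl)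

  𝟙-stray : ∀ {w} → w ≢ root → 𝟙 (stray? G T w) ≡ 𝟙 (nonAdjacent? G w (parent w))
  𝟙-stray {w} w≢root = cong (λ b → bit (not b Bool.∧ does (nonAdjacent? G w (parent w)))) (dec-false (w ≟ root) w≢root)

  defect≡0⇒edges : defect G T ≡ 0 → ∀ {w} → w ≢ root → Adjacent G w (parent w)
  defect≡0⇒edges defect≡0 {w} w≢root = decidable-stable (adjacent? G w (parent w)) λ ¬w~pw →
    contradiction (subst₂ _≤_ (𝟙-yes (stray? G T w) (w≢root , ¬w~pw)) defect≡0 (≤-∑ _ w)) λ ()

  stray-witness : defect G T ≢ 0 → ∃[ w ] Stray G T w
  stray-witness defect≢0 with any? (stray? G T)
  ... | yes found = found
  ... | no none = ⊥-elim (defect≢0 (∑-zero λ w → 𝟙-no (stray? G T w) (λ stray → none (w , stray))))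

  tree-⊆ : defect G T ≡ 0 → Tree.graph T ⊆G G
  tree-⊆ defect≡0 u v u~v = [ up , down ] (Equivalence.to adjacent⇔linked u~v)
    where
    up : ChildOf u v → Adjacent G u v
    up (u≢root , pu≡v) = subst (Adjacent G u) pu≡v (defect≡0⇒edges defect≡0 u≢root)
    down : ChildOf v u → Adjacent G u v
    down (v≢root , pv≡u) = trans (Graph.sym G u v) (subst (Adjacent G v) pv≡u (defect≡0⇒edges defect≡0 v≢root))

module Promote {n} (T : RootedTree n) {c} (c→root : Tree.ChildOf T c (Tree.root T)) where
  open Tree T
  private
    c≢root = proj₁ c→root
    pc≡root = proj₂ c→root

  parent′ : Fin n → Fin n
  parent′ w = if does (w ≟ root) then c else if does (w ≟ c) then c else parent w

  parent′-root : parent′ root ≡ c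
  parent′-root = if-yes (root ≟ root) refl

  parent′-c : parent′ c ≡ c
  parent′-c = trans (if-no (c ≟ root) c≢root) (if-yes (c ≟ c) refl)

  parent′-other : ∀ {w} → w ≢ root → w ≢ c → parent′ w ≡ parent w
  parent′-other {w} w≢root w≢c = trans (if-no (w ≟ root) w≢root) (if-no (w ≟ c) w≢c)

  reaches-c : ∀ k w → iterate parent k w ≡ root → ∃[ k′ ] iterate parent′ k′ w ≡ c
  reaches-c zero w refl = 1 , parent′-root
  reaches-c (suc k) w at-root with toSum (w ≟ c) | toSum (w ≟ root)
  ... | inj₁ w≡c | _ = 0 , w≡c
  ... | inj₂ _ | inj₁ refl = 1 , parent′-root
  ... | inj₂ w≢c | inj₂ w≢root with reaches-c k (parent w) at-root
  ...   | k′ , reaches = suc k′ , trans (cong (iterate parent′ k′) (parent′-other w≢root w≢c)) reaches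

  promoted : RootedTree n
  promoted = record
    { root         = c
    ; parent       = parent′
    ; parent-root  = parent′-c
    ; reaches-root = λ w → reaches-c (proj₁ (reaches-root w)) w (proj₂ (reaches-root w))
    }

  child→linked′ : ∀ {u v} → ChildOf u v → Tree.Linked promoted u v
  child→linked′ {u} (u≢root , refl) with toSum (u ≟ c)
  ... | inj₁ u≡c = inj₂ ((λ pu≡c → c≢root (trans (sym pu≡c) pu≡root)) ,
                         trans (cong parent′ pu≡root) (trans parent′-root (sym u≡c)))
    where
    pu≡root : parent u ≡ root
    pu≡root = trans (cong parent u≡c) pc≡root
  ... | inj₂ u≢c = inj₁ (u≢c , parent′-other u≢root u≢c)

  child′→linked : ∀ {u v} → Tree.ChildOf promoted u v → Linked u v
  child′→linked {u} (u≢c , refl) with toSum (u ≟ root)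
  ... | inj₁ refl = inj₂ (subst (λ v → ChildOf v root) (sym parent′-root) c→root)
  ... | inj₂ u≢root = inj₁ (u≢root , sym (parent′-other u≢root u≢c))

  sameEdges : SameEdges T promoted
  sameEdges u v = mk⇔ [ child→linked′ , Sum.swap ∘ child→linked′ ] [ child′→linked , Sum.swap ∘ child′→linked ]

  defect-promoted : (G : Graph n) → defect G promoted ≡ defect G T
  defect-promoted G = +-cancelʳ-≡ _ _ _ (begin
    defect G promoted + (𝟙 (stray? G T root) + 𝟙 (stray? G T c))
      ≡⟨ ∑-update₂ _ _ (λ root≡c → c≢root (sym root≡c)) unchanged ⟩
    defect G T + (𝟙 (stray? G promoted root) + 𝟙 (stray? G promoted c))
      ≡⟨ cong (λ s → defect G T + s) (+-comm (𝟙 (stray? G promoted root)) _) ⟩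
    defect G T + (𝟙 (stray? G promoted c) + 𝟙 (stray? G promoted root))
      ≡⟨ cong (λ s → defect G T + s) (cong₂ _+_ (trans (𝟙-stray-root G promoted) (sym (𝟙-stray-root G T))) swapped) ⟩
    defect G T + (𝟙 (stray? G T root) + 𝟙 (stray? G T c)) ∎)
    where
    open ≡-Reasoning
    unchanged : ∀ w → w ≢ root → w ≢ c → 𝟙 (stray? G promoted w) ≡ 𝟙 (stray? G T w)
    unchanged w w≢root w≢c = begin
      𝟙 (stray? G promoted w)                    ≡⟨ 𝟙-stray G promoted w≢c ⟩
      𝟙 (nonAdjacent? G w (parent′ w))           ≡⟨ cong (𝟙 ∘ nonAdjacent? G w) (parent′-other w≢root w≢c) ⟩
      𝟙 (nonAdjacent? G w (parent w))            ≡⟨ 𝟙-stray G T w≢root ⟨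
      𝟙 (stray? G T w)                           ∎
    swapped : 𝟙 (stray? G promoted root) ≡ 𝟙 (stray? G T c)
    swapped = begin
      𝟙 (stray? G promoted root)                 ≡⟨ 𝟙-stray G promoted (λ root≡c → c≢root (sym root≡c)) ⟩
      𝟙 (nonAdjacent? G root (parent′ root))     ≡⟨ cong (𝟙 ∘ nonAdjacent? G root) parent′-root ⟩
      𝟙 (nonAdjacent? G root c)                  ≡⟨ 𝟙-nonAdjacent-sym G root c ⟩
      𝟙 (nonAdjacent? G c root)                  ≡⟨ cong (𝟙 ∘ nonAdjacent? G c) pc≡root ⟨
      𝟙 (nonAdjacent? G c (parent c))            ≡⟨ 𝟙-stray G T c≢root ⟨
      𝟙 (stray? G T c)                           ∎

  descendant-promoted : ∀ {z} → Descendant c z → ¬ Tree.Descendant promoted root z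
  descendant-promoted {z} z∈ (j , reaches) =
    root-not-descendant c≢root (subst (Descendant c) reaches (iterate-closed parent′ (Descendant c) closed j z∈))
    where
    closed : ∀ w → Descendant c w → Descendant c (parent′ w)
    closed w w∈ with toSum (w ≟ c)
    ... | inj₁ refl = subst (Descendant c) (sym parent′-c) (descendant-refl c)
    ... | inj₂ w≢c = subst (Descendant c) (sym (parent′-other w≢root w≢c)) (descendant-parent w≢c w∈)
      where
      w≢root : w ≢ root
      w≢root refl = root-not-descendant c≢root w∈

record SameTree {n} (G : Graph n) (T T′ : RootedTree n) : Set where
  field
    sameEdges  : SameEdges T T′
    sameDefect : defect G T′ ≡ defect G T

module _ {n} (G : Graph n) where

  sameTree-refl : ∀ {T} → SameTree G T T
  sameTree-refl = record { sameEdges = λ u v → ⇔.refl ; sameDefect = refl }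

  sameTree-trans : ∀ {T₁ T₂ T₃} → SameTree G T₁ T₂ → SameTree G T₂ T₃ → SameTree G T₁ T₃
  sameTree-trans same₁₂ same₂₃ = record
    { sameEdges  = λ u v → ⇔.trans (SameTree.sameEdges same₁₂ u v) (SameTree.sameEdges same₂₃ u v)
    ; sameDefect = trans (SameTree.sameDefect same₂₃) (SameTree.sameDefect same₁₂)
    }

  promote-sameTree : ∀ T {c} (c→root : Tree.ChildOf T c (Tree.root T)) → SameTree G T (Promote.promoted T c→root)
  promote-sameTree T c→root = record
    { sameEdges  = Promote.sameEdges T c→root
    ; sameDefect = Promote.defect-promoted T c→root G
    }

  reroot : ∀ T k u → iterate (Tree.parent T) k u ≡ Tree.root T →
           Σ (RootedTree n) λ T′ → Tree.root T′ ≡ u × SameTree G T T′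
  reroot T zero u refl = T , refl , sameTree-refl
  reroot T (suc k) u at-root with toSum (u ≟ Tree.root T)
  ... | inj₁ u≡root = T , sym u≡root , sameTree-refl
  ... | inj₂ u≢root with reroot T k (Tree.parent T u) at-root
  ...   | T₁ , root₁≡pu , same₁ =
    Promote.promoted T₁ u→root₁ , refl , sameTree-trans same₁ (promote-sameTree T₁ u→root₁)
    where
    u~root₁ : Tree.Linked T₁ u (Tree.root T₁)
    u~root₁ = subst (Tree.Linked T₁ u) (sym root₁≡pu)
                (Equivalence.to (SameTree.sameEdges same₁ u _) (inj₁ (u≢root , refl)))
    u→root₁ : Tree.ChildOf T₁ u (Tree.root T₁)
    u→root₁ = Tree.linked-to-root T₁ u~root₁

  rerootAt : ∀ T u → Σ (RootedTree n) λ T′ → Tree.root T′ ≡ u × SameTree G T T′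
  rerootAt T u = reroot T (proj₁ (Tree.reaches-root T u)) u (proj₂ (Tree.reaches-root T u))

  stray-at-root : ∀ T → defect G T ≢ 0 →
                  Σ (RootedTree n) λ T₁ → SameTree G T T₁ ×
                    ∃[ x ] Tree.ChildOf T₁ x (Tree.root T₁) × ¬ Adjacent G x (Tree.root T₁)
  stray-at-root T defect≢0 =
    let x , x≢root , ¬x~px = stray-witness G T defect≢0
        T₁ , root₁≡px , same = rerootAt T (Tree.parent T x)
        x~root₁ : Tree.Linked T₁ x (Tree.root T₁)
        x~root₁ = subst (Tree.Linked T₁ x) (sym root₁≡px)
                    (Equivalence.to (SameTree.sameEdges same x (Tree.parent T x)) (inj₁ (x≢root , refl)))
    in T₁ , same , x , Tree.linked-to-root T₁ x~root₁ , subst (¬_ ∘ Adjacent G x) (sym root₁≡px) ¬x~px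

-- c takes over the parent of z and z becomes a child of the root: composing parent with the
-- transposition (c z) does exactly this, so children counts are merely permuted. Since z lies
-- outside the subtree of c, every vertex still reaches the root.
module Exchange {n} (T : RootedTree n) {c} (c→root : Tree.ChildOf T c (Tree.root T))
                {z} (z≢root : z ≢ Tree.root T) (z∉ : ¬ Tree.Descendant T c z) where
  open Tree T
  private
    c≢root = proj₁ c→root
    pc≡root = proj₂ c→root
    z≢c : z ≢ c
    z≢c z≡c = z∉ (subst (Descendant c) (sym z≡c) (descendant-refl c))

  τ : Fin n → Fin n
  τ = Perm.transpose c z

  τ-root : τ root ≡ root
  τ-root = transpose-fix (c≢root ∘ sym) (z≢root ∘ sym)

  τ≡root⇔ : ∀ {w} → τ w ≡ root ⇔ w ≡ root
  τ≡root⇔ {w} = mk⇔ (λ τw≡root → trans (sym (transpose-involutive c z w)) (trans (cong τ τw≡root) τ-root))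
                    (λ { refl → τ-root })

  parent′ : Fin n → Fin n
  parent′ w = parent (τ w)

  parent′-c : parent′ c ≡ parent z
  parent′-c = cong parent (transpose-ˡ c z)

  parent′-z : parent′ z ≡ root
  parent′-z = trans (cong parent (transpose-ʳ c z)) pc≡root

  parent′-other : ∀ {w} → w ≢ c → w ≢ z → parent′ w ≡ parent w
  parent′-other w≢c w≢z = cong parent (transpose-fix w≢c w≢z)

  reaches-outside : ∀ k w → iterate parent k w ≡ root → ¬ Descendant c w → ∃[ k′ ] iterate parent′ k′ w ≡ root
  reaches-outside zero w at-root _ = 0 , at-root
  reaches-outside (suc k) w at-root w∉ with toSum (w ≟ z) | toSum (w ≟ root)
  ... | inj₁ refl | _ = 1 , parent′-z
  ... | inj₂ _ | inj₁ w≡root = 0 , w≡root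
  ... | inj₂ w≢z | inj₂ _ with reaches-outside k (parent w) at-root (w∉ ∘ descendant-child)
  ...   | k′ , reaches = suc k′ , trans (cong (iterate parent′ k′) (parent′-other w≢c w≢z)) reaches
    where
    w≢c : w ≢ c
    w≢c w≡c = w∉ (subst (Descendant c) (sym w≡c) (descendant-refl c))

  reaches-inside : ∀ j w → iterate parent j w ≡ c → ∃[ k′ ] iterate parent′ k′ w ≡ root
  reaches-inside j w reaches-c with toSum (w ≟ c)
  ... | inj₁ refl with reaches-root (parent z)
  ...   | k , pz-reaches with reaches-outside k (parent z) pz-reaches (z∉ ∘ descendant-child)
  ...     | k′ , reaches = suc k′ , trans (cong (iterate parent′ k′) parent′-c) reaches
  reaches-inside zero w w≡c | inj₂ w≢c = ⊥-elim (w≢c w≡c)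
  reaches-inside (suc j) w reaches-c | inj₂ w≢c with reaches-inside j (parent w) reaches-c
  ... | k′ , reaches = suc k′ , trans (cong (iterate parent′ k′) (parent′-other w≢c w≢z)) reaches
    where
    w≢z : w ≢ z
    w≢z w≡z = z∉ (subst (Descendant c) w≡z (suc j , reaches-c))

  exchanged : RootedTree n
  exchanged = record
    { root         = root
    ; parent       = parent′
    ; parent-root  = trans (cong parent τ-root) parent-root
    ; reaches-root = reaches
    }
    where
    reaches : ∀ w → ∃[ k ] iterate parent′ k w ≡ root
    reaches w with descendant? c w
    ... | yes (j , reaches-c) = reaches-inside j w reaches-c
    ... | no w∉ = reaches-outside (proj₁ (reaches-root w)) w (proj₂ (reaches-root w)) w∉

  degree-exchanged : ∀ v → Tree.degree exchanged v ≡ degree v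
  degree-exchanged v = cong (notRoot v +_) (children-transpose T exchanged c z λ w →
    mk⇔ (map₁ (λ w≢root → w≢root ∘ Equivalence.to τ≡root⇔))
        (map₁ (λ τw≢root → τw≢root ∘ Equivalence.from τ≡root⇔)))

  defect-exchanged : (G : Graph n) →
    defect G exchanged + (𝟙 (stray? G T c) + 𝟙 (stray? G T z)) ≡
    defect G T + (𝟙 (nonAdjacent? G c (parent z)) + 𝟙 (nonAdjacent? G z root))
  defect-exchanged G = trans (∑-update₂ _ _ (z≢c ∘ sym) unchanged)
                             (cong (defect G T +_) (cong₂ _+_ moved-c moved-z))
    where
    unchanged : ∀ w → w ≢ c → w ≢ z → 𝟙 (stray? G exchanged w) ≡ 𝟙 (stray? G T w)
    unchanged w w≢c w≢z with toSum (w ≟ root)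
    ... | inj₁ refl = trans (𝟙-stray-root G exchanged) (sym (𝟙-stray-root G T))
    ... | inj₂ w≢root = trans (𝟙-stray G exchanged w≢root)
                        (trans (cong (𝟙 ∘ nonAdjacent? G w) (parent′-other w≢c w≢z)) (sym (𝟙-stray G T w≢root)))
    moved-c : 𝟙 (stray? G exchanged c) ≡ 𝟙 (nonAdjacent? G c (parent z))
    moved-c = trans (𝟙-stray G exchanged c≢root) (cong (𝟙 ∘ nonAdjacent? G c) parent′-c)
    moved-z : 𝟙 (stray? G exchanged z) ≡ 𝟙 (nonAdjacent? G z root)
    moved-z = trans (𝟙-stray G exchanged z≢root) (cong (𝟙 ∘ nonAdjacent? G z) parent′-z)

  defect-exchanged-< : (G : Graph n) → Stray G T c → Adjacent G c (parent z) → Adjacent G z root →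
                       defect G exchanged < defect G T
  defect-exchanged-< G c-stray c~pz z~root = begin-strict
    defect G exchanged
      <⟨ m<m+n _ (s≤s z≤n) ⟩
    defect G exchanged + suc (𝟙 (stray? G T z))
      ≡⟨ cong (λ s → defect G exchanged + (s + _)) (𝟙-yes (stray? G T c) c-stray) ⟨
    defect G exchanged + (𝟙 (stray? G T c) + 𝟙 (stray? G T z))
      ≡⟨ defect-exchanged G ⟩
    defect G T + (𝟙 (nonAdjacent? G c (parent z)) + 𝟙 (nonAdjacent? G z root))
      ≡⟨ cong (defect G T +_) (cong₂ _+_ (𝟙-no (nonAdjacent? G c _) (_$ c~pz)) (𝟙-no (nonAdjacent? G z root) (_$ z~root))) ⟩
    defect G T + 0
      ≡⟨ +-identityʳ _ ⟩
    defect G T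
      ∎
    where open ≤-Reasoning

-- The counting argument

module _ {n} (G : Graph n) where

  NonNeighbour : Fin n → Fin n → Set
  NonNeighbour a w = w ≢ a × ¬ Adjacent G a w

  nonNeighbour? : ∀ a w → Dec (NonNeighbour a w)
  nonNeighbour? a w = ¬? (w ≟ a) ×-dec nonAdjacent? G a w

  nonNeighbours : Fin n → ℕ
  nonNeighbours a = ∑[ w < n ] 𝟙 (nonNeighbour? a w)

  nonNeighbours+deg : ∀ a → nonNeighbours a + deg G a + 1 ≡ n
  nonNeighbours+deg a = begin
    nonNeighbours a + deg G a + 1
      ≡⟨ cong₂ (λ d e → nonNeighbours a + d + e) (count-tabulate (adj G a) (λ w → w)) (sym (∑-δ a)) ⟩
    nonNeighbours a + ∑[ w < n ] bit (adj G a w) + ∑[ w < n ] δ a w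
      ≡⟨ cong (_+ ∑[ w < n ] δ a w) (∑-distrib-+ (λ w → 𝟙 (nonNeighbour? a w)) (λ w → bit (adj G a w))) ⟨
    ∑[ w < n ] (𝟙 (nonNeighbour? a w) + bit (adj G a w)) + ∑[ w < n ] δ a w
      ≡⟨ ∑-distrib-+ (λ w → 𝟙 (nonNeighbour? a w) + bit (adj G a w)) (δ a) ⟨
    ∑[ w < n ] (𝟙 (nonNeighbour? a w) + bit (adj G a w) + δ a w)
      ≡⟨ sum-cong-≗ partition ⟩
    ∑[ w < n ] 1
      ≡⟨ trans (∑-const n 1) (*-identityʳ n) ⟩
    n ∎
    where
    open ≡-Reasoning
    partition : ∀ w → 𝟙 (nonNeighbour? a w) + bit (adj G a w) + δ a w ≡ 1
    partition w with toSum (w ≟ a)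
    ... | inj₁ refl rewrite Graph.irrefl G w | dec-true (w ≟ w) refl = refl
    ... | inj₂ w≢a rewrite 𝟙-no (a ≟ w) (w≢a ∘ sym) | dec-false (w ≟ a) w≢a with adj G a w
    ...   | true = refl
    ...   | false = refl

-- If a candidate z below x is not exchangeable, then z is a non-neighbour of x or its parent is
-- one of the root, and symmetrically for z outside the subtree of x; near and far count these.
-- Each vertex is the parent of at most R candidates, so n − 2 ≤ R (m(x) + m(root)) where m
-- counts non-neighbours.
module Counting {n} (G : Graph n) (T : RootedTree n) {x} (x→root : Tree.ChildOf T x (Tree.root T))
                (R : ℕ) .{{_ : NonZero R}} (degree≤ : ∀ v → Tree.degree T v ≤ suc R) where
  open Tree T
  private
    x≢root = proj₁ x→root
    px≡root = proj₂ x→root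

  Exchangeable : Fin n → Set
  Exchangeable z = (¬ Descendant x z × Adjacent G x (parent z) × Adjacent G z root)
                 ⊎ (Descendant x z × Adjacent G root (parent z) × Adjacent G z x)

  exchangeable? : ∀ z → Dec (Exchangeable z)
  exchangeable? z = (¬? (descendant? x z) ×-dec adjacent? G x (parent z) ×-dec adjacent? G z root)
                  ⊎-dec (descendant? x z ×-dec adjacent? G root (parent z) ×-dec adjacent? G z x)

  Candidate : Fin n → Set
  Candidate z = z ≢ root × z ≢ x

  candidate? : ∀ z → Dec (Candidate z)
  candidate? z = ¬? (z ≟ root) ×-dec ¬? (z ≟ x)

  ∑-candidate : ∑[ z < n ] 𝟙 (candidate? z) + 2 ≡ n
  ∑-candidate = begin
    ∑[ z < n ] 𝟙 (candidate? z) + 2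
      ≡⟨ cong₂ (λ a b → ∑[ z < n ] 𝟙 (candidate? z) + (a + b)) (∑-δ root) (∑-δ x) ⟨
    ∑[ z < n ] 𝟙 (candidate? z) + (∑[ z < n ] δ root z + ∑[ z < n ] δ x z)
      ≡⟨ cong (∑[ z < n ] 𝟙 (candidate? z) +_) (∑-distrib-+ (δ root) (δ x)) ⟨
    ∑[ z < n ] 𝟙 (candidate? z) + ∑[ z < n ] (δ root z + δ x z)
      ≡⟨ ∑-distrib-+ (λ z → 𝟙 (candidate? z)) (λ z → δ root z + δ x z) ⟨
    ∑[ z < n ] (𝟙 (candidate? z) + (δ root z + δ x z))
      ≡⟨ sum-cong-≗ partition ⟩
    ∑[ z < n ] 1
      ≡⟨ trans (∑-const n 1) (*-identityʳ n) ⟩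
    n ∎
    where
    open ≡-Reasoning
    partition : ∀ z → 𝟙 (candidate? z) + (δ root z + δ x z) ≡ 1
    partition z with toSum (z ≟ root) | toSum (z ≟ x)
    ... | inj₁ refl | _
      rewrite dec-true (z ≟ z) refl | dec-false (x ≟ z) x≢root = refl
    ... | inj₂ _ | inj₁ refl
      rewrite dec-true (z ≟ z) refl | dec-false (root ≟ z) (x≢root ∘ sym) | dec-false (z ≟ root) x≢root = refl
    ... | inj₂ z≢root | inj₂ z≢x
      rewrite dec-false (root ≟ z) (z≢root ∘ sym) | dec-false (x ≟ z) (z≢x ∘ sym)
            | dec-false (z ≟ root) z≢root | dec-false (z ≟ x) z≢x = refl

  candidateChildren+δ : ∀ w → ∑[ z < n ] (δ (parent z) w * 𝟙 (candidate? z)) + δ root w ≡ children w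
  candidateChildren+δ w = begin
    candidateChildren + δ root w                     ≡⟨ cong (candidateChildren +_) at-x ⟨
    candidateChildren + 𝟙 (childOf? x w)             ≡⟨ ∑-update x _ _ away ⟩
    children w + δ (parent x) w * 𝟙 (candidate? x)   ≡⟨ cong (λ e → children w + δ (parent x) w * e) x-excluded ⟩
    children w + δ (parent x) w * 0                  ≡⟨ cong (children w +_) (*-zeroʳ (δ (parent x) w)) ⟩
    children w + 0                                   ≡⟨ +-identityʳ (children w) ⟩
    children w                                       ∎
    where
    open ≡-Reasoning
    candidateChildren = ∑[ z < n ] (δ (parent z) w * 𝟙 (candidate? z))
    at-x : 𝟙 (childOf? x w) ≡ δ root w
    at-x = 𝟙-cong (childOf? x w) (root ≟ w)
      (mk⇔ (λ (_ , px≡w) → trans (sym px≡root) px≡w) (λ root≡w → x≢root , trans px≡root root≡w))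
    x-excluded : 𝟙 (candidate? x) ≡ 0
    x-excluded = 𝟙-no (candidate? x) λ (_ , x≢x) → x≢x refl
    away : ∀ z → z ≢ x → δ (parent z) w * 𝟙 (candidate? z) ≡ 𝟙 (childOf? z w)
    away z z≢x with toSum (z ≟ root)
    ... | inj₁ refl = trans (cong (δ (parent root) w *_) (𝟙-no (candidate? root) λ (root≢root , _) → root≢root refl))
                           (trans (*-zeroʳ (δ (parent root) w)) (sym (𝟙-no (childOf? root w) root-not-child)))
    ... | inj₂ z≢root = trans (cong (δ (parent z) w *_) (𝟙-yes (candidate? z) (z≢root , z≢x)))
                             (trans (*-identityʳ _) (𝟙-cong (parent z ≟ w) (childOf? z w) (mk⇔ (z≢root ,_) proj₂)))

  -- x is the only child of the root that is not a candidate.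
  candidate-children≤ : ∀ w → ∑[ z < n ] (δ (parent z) w * 𝟙 (candidate? z)) ≤ R
  candidate-children≤ w = ≤-pred (subst (_≤ suc R) degree≡ (degree≤ w))
    where
    open ≡-Reasoning
    cc = ∑[ z < n ] (δ (parent z) w * 𝟙 (candidate? z))
    degree≡ : degree w ≡ suc cc
    degree≡ = begin
      notRoot w + children w              ≡⟨ cong (notRoot w +_) (candidateChildren+δ w) ⟨
      notRoot w + (cc + δ root w)         ≡⟨ rearrange (notRoot w) cc (δ root w) ⟩
      cc + (notRoot w + δ root w)         ≡⟨ cong (cc +_) (notRoot+δ w) ⟩
      cc + 1                              ≡⟨ +-comm cc 1 ⟩
      suc cc                              ∎
      where
      rearrange : ∀ a b c → a + (b + c) ≡ b + (a + c)
      rearrange = solve-∀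

  isNonNeighbour : Fin n → Fin n → ℕ
  isNonNeighbour a w = 𝟙 (nonNeighbour? G a w)

  isNonNeighbour-yes : ∀ a w → w ≢ a → ¬ Adjacent G a w → isNonNeighbour a w ≡ 1
  isNonNeighbour-yes a w w≢a ¬a~w = 𝟙-yes (nonNeighbour? G a w) (w≢a , ¬a~w)

  near far : Fin n → ℕ
  near w = if does (descendant? x w) then isNonNeighbour x w else isNonNeighbour root w
  far w = if does (descendant? x w) then isNonNeighbour root w else isNonNeighbour x w

  near+far : ∀ w → near w + far w ≡ isNonNeighbour x w + isNonNeighbour root w
  near+far w with toSum (descendant? x w)
  ... | inj₁ w∈ rewrite dec-true (descendant? x w) w∈ = refl
  ... | inj₂ w∉ rewrite dec-false (descendant? x w) w∉ = +-comm (isNonNeighbour root w) (isNonNeighbour x w)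

  blocked : ∀ {z} → Candidate z → ¬ Exchangeable z → near z ≡ 1 ⊎ far (parent z) ≡ 1
  blocked {z} (z≢root , z≢x) ¬exchangeable with toSum (descendant? x z)
  ... | inj₁ z∈ with toSum (adjacent? G z x) | toSum (adjacent? G root (parent z))
  ...   | inj₂ ¬z~x | _ =
    inj₁ (trans (if-yes (descendant? x z) z∈) (isNonNeighbour-yes x z z≢x (¬adjacent-sym G ¬z~x)))
  ...   | inj₁ _ | inj₂ ¬root~pz =
    inj₂ (trans (if-yes (descendant? x (parent z)) pz∈) (isNonNeighbour-yes root (parent z) pz≢root ¬root~pz))
    where
    pz∈ = descendant-parent z≢x z∈
    pz≢root : parent z ≢ root
    pz≢root pz≡root = root-not-descendant x≢root (subst (Descendant x) pz≡root pz∈)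
  ...   | inj₁ z~x | inj₁ root~pz = ⊥-elim (¬exchangeable (inj₂ (z∈ , root~pz , z~x)))
  blocked {z} (z≢root , z≢x) ¬exchangeable | inj₂ z∉ with toSum (adjacent? G z root) | toSum (adjacent? G x (parent z))
  ...   | inj₂ ¬z~root | _ =
    inj₁ (trans (if-no (descendant? x z) z∉) (isNonNeighbour-yes root z z≢root (¬adjacent-sym G ¬z~root)))
  ...   | inj₁ _ | inj₂ ¬x~pz =
    inj₂ (trans (if-no (descendant? x (parent z)) (z∉ ∘ descendant-child)) (isNonNeighbour-yes x (parent z) pz≢x ¬x~pz))
    where
    pz≢x : parent z ≢ x
    pz≢x pz≡x = z∉ (descendant-child (subst (Descendant x) (sym pz≡x) (descendant-refl x)))
  ...   | inj₁ z~root | inj₁ x~pz = ⊥-elim (¬exchangeable (inj₁ (z∉ , x~pz , z~root)))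

  candidates≤ : (∀ z → Candidate z → ¬ Exchangeable z) →
                ∑[ z < n ] 𝟙 (candidate? z) ≤ R * (nonNeighbours G x + nonNeighbours G root)
  candidates≤ none = begin
    ∑[ z < n ] 𝟙 (candidate? z)
      ≤⟨ ∑-mono-≤ pointwise ⟩
    ∑[ z < n ] (near z + 𝟙 (candidate? z) * far (parent z))
      ≡⟨ ∑-distrib-+ near (λ z → 𝟙 (candidate? z) * far (parent z)) ⟩
    sum near + ∑[ z < n ] (𝟙 (candidate? z) * far (parent z))
      ≤⟨ +-mono-≤ (m≤n*m (sum near) R) (∑-fibres-≤ parent _ far R candidate-children≤) ⟩
    R * sum near + R * sum far
      ≡⟨ *-distribˡ-+ R (sum near) (sum far) ⟨
    R * (sum near + sum far)
      ≡⟨ cong (R *_) (∑-distrib-+ near far) ⟨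
    R * ∑[ w < n ] (near w + far w)
      ≡⟨ cong (R *_) (trans (sum-cong-≗ near+far) (∑-distrib-+ (isNonNeighbour x) (isNonNeighbour root))) ⟩
    R * (nonNeighbours G x + nonNeighbours G root)
      ∎
    where
    open ≤-Reasoning
    one≤ : ∀ {a b} → a ≡ 1 ⊎ b ≡ 1 → 1 ≤ a + 1 * b
    one≤ (inj₁ refl) = s≤s z≤n
    one≤ {a} (inj₂ refl) = m≤n+m 1 a
    pointwise : ∀ z → 𝟙 (candidate? z) ≤ near z + 𝟙 (candidate? z) * far (parent z)
    pointwise z with toSum (candidate? z)
    ... | inj₁ candidate = subst (λ e → e ≤ near z + e * far (parent z)) (sym (𝟙-yes (candidate? z) candidate))
                                 (one≤ (blocked candidate (none z candidate)))
    ... | inj₂ ¬candidate = subst (_≤ near z + 𝟙 (candidate? z) * far (parent z))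
                                  (sym (𝟙-no (candidate? z) ¬candidate)) z≤n

  exchangeable-exists : R * (nonNeighbours G x + nonNeighbours G root) + 3 ≤ n →
                        ∃[ z ] Candidate z × Exchangeable z
  exchangeable-exists room with any? (λ z → candidate? z ×-dec exchangeable? z)
  ... | yes found = found
  ... | no none = contradiction (+-cancelˡ-≤ (∑[ z < n ] 𝟙 (candidate? z)) 3 2 too-many) λ { (s≤s (s≤s ())) }
    where
    too-many : ∑[ z < n ] 𝟙 (candidate? z) + 3 ≤ ∑[ z < n ] 𝟙 (candidate? z) + 2
    too-many = begin
      ∑[ z < n ] 𝟙 (candidate? z) + 3
        ≤⟨ +-monoˡ-≤ 3 (candidates≤ λ z c e → none (z , c , e)) ⟩
      R * (nonNeighbours G x + nonNeighbours G root) + 3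
        ≤⟨ room ⟩
      n
        ≡⟨ ∑-candidate ⟨
      ∑[ z < n ] 𝟙 (candidate? z) + 2
        ∎
      where open ≤-Reasoning

-- Decreasing the defect

descend : ∀ {A : Set} (μ : A → ℕ) (P : A → Set) →
          (∀ a → P a → μ a ≢ 0 → Σ A λ b → P b × μ b < μ a) →
          ∀ a → P a → Σ A λ b → P b × μ b ≡ 0
descend {A} μ P decrease a Pa = go a Pa (<-wellFounded (μ a))
  where
  go : ∀ a → P a → Acc _<_ (μ a) → Σ A λ b → P b × μ b ≡ 0
  go a Pa (acc smaller) with μ a ℕ.≟ 0
  ... | yes μa≡0 = a , Pa , μa≡0
  ... | no μa≢0 with decrease a Pa μa≢0
  ...   | b , Pb , μb<μa = go b Pb (smaller μb<μa)

Improvement : ∀ {n} → Graph n → RootedTree n → Set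
Improvement {n} G T = Σ (RootedTree n) λ T′ → (∀ v → Tree.degree T′ v ≡ Tree.degree T v) × defect G T′ < defect G T

module _ {n} (G : Graph n) (R : ℕ) .{{_ : NonZero R}} where

  exchange-step : ∀ T {x} (x→root : Tree.ChildOf T x (Tree.root T)) → ¬ Adjacent G x (Tree.root T) →
                  (∀ v → Tree.degree T v ≤ suc R) →
                  R * (nonNeighbours G x + nonNeighbours G (Tree.root T)) + 3 ≤ n → Improvement G T
  exchange-step T {x} x→root ¬x~root degree≤ room with Counting.exchangeable-exists G T x→root R degree≤ room
  ... | z , (z≢root , _) , inj₁ (z∉ , x~pz , z~root) =
    exchanged , degree-exchanged , defect-exchanged-< G x-stray x~pz z~root
    where
    open Exchange T x→root z≢root z∉ using (exchanged; degree-exchanged; defect-exchanged-<)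
    x-stray : Stray G T x
    x-stray = proj₁ x→root , subst (¬_ ∘ Adjacent G x) (sym (proj₂ x→root)) ¬x~root
  ... | z , (z≢root , z≢x) , inj₂ (z∈ , root~pz , z~x) =
    exchanged ,
    (λ v → trans (degree-exchanged v) (degree-sameEdges T promoted sameEdges v)) ,
    subst (defect G exchanged <_) (defect-promoted G) (defect-exchanged-< G root-stray root~pz′ z~x)
    where
    open Promote T x→root using (promoted; sameEdges; defect-promoted; parent′-root; parent′-other; descendant-promoted)
    root→x : Tree.ChildOf promoted (Tree.root T) x
    root→x = proj₁ x→root ∘ sym , parent′-root
    open Exchange promoted root→x z≢x (descendant-promoted z∈) using (exchanged; degree-exchanged; defect-exchanged-<)
    root-stray : Stray G promoted (Tree.root T)
    root-stray = proj₁ root→x , subst (¬_ ∘ Adjacent G (Tree.root T)) (sym parent′-root) (¬adjacent-sym G ¬x~root)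
    root~pz′ : Adjacent G (Tree.root T) (Tree.parent promoted z)
    root~pz′ = subst (Adjacent G (Tree.root T)) (sym (parent′-other z≢root z≢x)) root~pz

room-from-degree-sum : ∀ t n D M → M + D + 2 ≡ 2 * n →
                       suc (2 * t) * n + 5 ≤ suc t * D + 2 * suc (suc t) →
                       suc t * M + 3 ≤ n
room-from-degree-sum t n D M sum≡ hyp = +-cancelˡ-≤ (suc (2 * t) * n) _ _ (+-cancelʳ-≤ 2 _ _ (begin
  suc (2 * t) * n + (suc t * M + 3) + 2     ≡⟨ e₁ t n M ⟩
  suc (2 * t) * n + 5 + suc t * M           ≤⟨ +-monoˡ-≤ (suc t * M) hyp ⟩
  suc t * D + 2 * suc (suc t) + suc t * M   ≡⟨ e₂ t D M ⟩
  suc t * (M + D + 2) + 2                   ≡⟨ cong (λ s → suc t * s + 2) sum≡ ⟩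
  suc t * (2 * n) + 2                       ≡⟨ e₃ t n ⟩
  suc (2 * t) * n + n + 2                   ∎))
  where
  open ≤-Reasoning
  e₁ : ∀ t n M → suc (2 * t) * n + (suc t * M + 3) + 2 ≡ suc (2 * t) * n + 5 + suc t * M
  e₁ = solve-∀
  e₂ : ∀ t D M → suc t * D + 2 * suc (suc t) + suc t * M ≡ suc t * (M + D + 2) + 2
  e₂ = solve-∀
  e₃ : ∀ t n → suc t * (2 * n) + 2 ≡ suc (2 * t) * n + n + 2
  e₃ = solve-∀

module _ {n} (G : Graph n) (t : ℕ)
         (dense : ∀ u v → u ≢ v → ¬ Adjacent G u v →
                  (2 * suc (suc t) ∸ 3) * n + 5 ≤ suc t * (deg G u + deg G v) + 2 * suc (suc t)) where

  room-for-exchange : ∀ {x y} → x ≢ y → ¬ Adjacent G x y →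
                      suc t * (nonNeighbours G x + nonNeighbours G y) + 3 ≤ n
  room-for-exchange {x} {y} x≢y ¬x~y = room-from-degree-sum t n _ _ sum≡ dense′
    where
    sum≡ : nonNeighbours G x + nonNeighbours G y + (deg G x + deg G y) + 2 ≡ 2 * n
    sum≡ = trans (regroup (nonNeighbours G x) (nonNeighbours G y) (deg G x) (deg G y))
                 (cong₂ (λ a b → a + (b + 0)) (nonNeighbours+deg G x) (nonNeighbours+deg G y))
      where
      regroup : ∀ a b c d → a + b + (c + d) + 2 ≡ a + c + 1 + (b + d + 1 + 0)
      regroup = solve-∀
    -- The truncated subtraction is exact since r ≥ 2.
    2r∸3 : 2 * suc (suc t) ∸ 3 ≡ suc (2 * t)
    2r∸3 = cong (_∸ 3) (shift t)
      where
      shift : ∀ t → 2 * suc (suc t) ≡ 3 + suc (2 * t)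
      shift = solve-∀
    dense′ : suc (2 * t) * n + 5 ≤ suc t * (deg G x + deg G y) + 2 * suc (suc t)
    dense′ = subst (λ k → k * n + 5 ≤ suc t * (deg G x + deg G y) + 2 * suc (suc t)) 2r∸3 (dense x y x≢y ¬x~y)

  reduce-defect : ∀ T → (∀ v → Tree.degree T v ≤ suc (suc t)) → defect G T ≢ 0 → Improvement G T
  reduce-defect T degree≤ defect≢0 =
    let T₁ , same , x , x→root₁ , ¬x~root₁ = stray-at-root G T defect≢0
        open SameTree same
        degree₁≤ : ∀ v → Tree.degree T₁ v ≤ suc (suc t)
        degree₁≤ v = subst (_≤ suc (suc t)) (sym (degree-sameEdges T T₁ sameEdges v)) (degree≤ v)
        T′ , degrees , smaller =
          exchange-step G (suc t) T₁ x→root₁ ¬x~root₁ degree₁≤ (room-for-exchange (proj₁ x→root₁) ¬x~root₁)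
    in T′ , (λ v → trans (degrees v) (degree-sameEdges T T₁ sameEdges v)) , subst (defect G T′ <_) sameDefect smaller

  realisation-within-G : ∀ (d : Fin n → ℕ) → (∀ i → d i ≤ suc (suc t)) → DegreeRealisation d →
                         Σ (RootedTree n) λ T → (∀ v → Tree.degree T v ≡ d v) × defect G T ≡ 0
  realisation-within-G d d≤r (T₀ , degrees₀) =
    descend (defect G) (λ T → ∀ v → Tree.degree T v ≡ d v) improve T₀ degrees₀
    where
    improve : ∀ T → (∀ v → Tree.degree T v ≡ d v) → defect G T ≢ 0 →
              Σ (RootedTree n) λ T′ → (∀ v → Tree.degree T′ v ≡ d v) × defect G T′ < defect G T
    improve T degrees defect≢0 =
      proj₁ reduced , (λ v → trans (proj₁ (proj₂ reduced) v) (degrees v)) , proj₂ (proj₂ reduced)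
      where
      reduced = reduce-defect T (λ v → subst (_≤ suc (suc t)) (sym (degrees v)) (d≤r v)) defect≢0

theorem3 : (r n : ℕ) → 2 ≤ r → r + 1 ≤ n → (G : Graph n) →
    (∀ u v → ¬ u ≡ v → ¬ Adjacent G u v →
    (2 * r ∸ 3) * n + 5 ≤ (r ∸ 1) * (deg G u + deg G v) + 2 * r) →
    (d : Fin n → ℕ) → Arboreal d → (∀ i → d i ≤ r) →
    Σ (Graph n) λ T → IsSpanningTree G T × HasDegSeq T d
theorem3 (suc (suc t)) zero _ () _ _ _ _ _
theorem3 (suc (suc t)) (suc zero) _ (s≤s ()) _ _ _ _ _
theorem3 (suc (suc t)) (suc (suc m)) (s≤s (s≤s z≤n)) _ G dense d (positive , sum≡) d≤r =
  Tree.graph T , (tree-⊆ G T defect≡0 , Tree.isTree T) , λ v → trans (Tree.deg-graph T v) (degrees v)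
  where
  initial : DegreeRealisation d
  initial = tree-with-degrees m d positive (trans (sym (sumFin≡∑ d)) sum≡)
  final : Σ (RootedTree (suc (suc m))) λ T → (∀ v → Tree.degree T v ≡ d v) × defect G T ≡ 0
  final = realisation-within-G G t dense d d≤r initial
  T = proj₁ final
  degrees = proj₁ (proj₂ final)
  defect≡0 = proj₂ (proj₂ final)
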